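{- Let $n\ge0$ and $0\le i,j<3^n$. Suppose that for every $t\ge0$, the $t$-th ternary digit of $i$ (counted from the least significant, digit $0$) equals $1$ if and only if the $t$-th ternary digit of $j$ equals $1$ (i.e. $i$ and $j$ have $1$s in exactly the same positions of their ternary representations). Then $C_n(i)=C_n(j)$.
   Context: The unit weight-$3$ Stern–Brocot sequences $SB_n$ ($n\ge0$): $SB_0=(\frac{0}{1},\frac{1}{1})$, and $SB_{n+1}$ is obtained from $SB_n$ by keeping all its terms in order and inserting, between each pair of consecutive terms $\frac{p}{q},\frac{r}{s}$ (in lowest terms, positive denominators), the two fractions $\frac{2p+r}{2q+s}$ and $\frac{p+2r}{q+2s}$, each reduced to lowest terms, in this order. $SB_n$ has $3^n+1$ terms, indexed from $0$. For $0\le i<3^n$, $C_n(i)=qr-ps$ where $\frac{p}{q}$ and $\frac{r}{s}$ are the $i$-th and $(i+1)$-th terms of $SB_n$ in lowest terms with positive denominators. -}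

module Defs where

open import Data.Nat using (ℕ; zero; suc; _^_; _%_)
import Data.Nat as ℕ
open import Data.Integer as ℤ using (ℤ; _-_)
open import Data.Rational using (ℚ; ↥_; ↧_; ↧ₙ_; 0ℚ; 1ℚ; _/_)
open ℚ using (denominator-1)
open import Data.List using (List; []; _∷_; [_])

-- Denominator of a rational as  suc (denominator-1)  so NonZero is found.
-- The two inserted fractions between p/q and r/s (both in lowest terms):
-- (2p+r)/(2q+s) and (p+2r)/(q+2s), normalised (ℚ._/_ reduces to lowest terms).
left-ins : ℚ → ℚ → ℚ
left-ins a b = (ℤ.+ 2 ℤ.* ↥ a ℤ.+ ↥ b) / suc (denominator-1 a ℕ.+ (suc (denominator-1 a) ℕ.+ suc (denominator-1 b)))

right-ins : ℚ → ℚ → ℚ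
right-ins a b = (↥ a ℤ.+ ℤ.+ 2 ℤ.* ↥ b) / suc (denominator-1 a ℕ.+ (suc (denominator-1 b) ℕ.+ suc (denominator-1 b)))

refine : List ℚ → List ℚ
refine [] = []
refine (a ∷ []) = a ∷ []
refine (a ∷ b ∷ rest) = a ∷ left-ins a b ∷ right-ins a b ∷ refine (b ∷ rest)

SB : ℕ → List ℚ
SB zero = 0ℚ ∷ 1ℚ ∷ []
SB (suc n) = refine (SB n)

cross : ℚ → ℚ → ℤ
cross a b = ↧ a ℤ.* ↥ b - ↥ a ℤ.* ↧ b

crossList : List ℚ → List ℤ
crossList [] = []
crossList (a ∷ []) = []
crossList (a ∷ b ∷ rest) = cross a b ∷ crossList (b ∷ rest)

nthOr : {A : Set} → A → List A → ℕ → A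
nthOr d [] _ = d
nthOr d (x ∷ xs) zero = x
nthOr d (x ∷ xs) (suc i) = nthOr d xs i

C : ℕ → ℕ → ℤ
C n i = nthOr (ℤ.+ 0) (crossList (SB n)) i

ternaryDigit : ℕ → ℕ → ℕ
ternaryDigit zero i = i % 3
ternaryDigit (suc t) i = ternaryDigit t (i ℕ./ 3)

{-# OPTIONS --safe #-}
-- Identify a fraction with the integer vector (numerator, denominator).  Every
-- pair a, b of consecutive terms of SB_n satisfies b = σ a + m w for a sign σ,
-- a power m of 3 and a vector w with det(a, w) = 1, so that C = det(a, b) = m.
-- The unreduced insertions 2a + b and a + 2b are 1 or 3 times a primitive vector,
-- and the three new consecutive pairs are again of this form, with (σ, m)
-- determined by the old (σ, m) and by whether the pair is the middle one, i.e.
-- whether the new ternary digit is 1.  Hence C_n(i) only depends on the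
-- positions of the digits 1 of i.
module Submission where

open import Defs
open import Data.Nat using (ℕ; _<_; _^_)
open import Relation.Binary.PropositionalEquality using (_≡_)
open import Function.Bundles using (_⇔_)

open import Data.Nat as ℕ using (zero; suc; _%_; _/_; s≤s)
import Data.Nat.Properties as ℕ
import Data.Nat.DivMod as ℕ
import Data.Nat.Divisibility as ℕ
import Data.Nat.GCD as ℕ
open import Data.Integer as ℤ using (ℤ; +_; -1ℤ; _+_; _-_; _*_; ∣_∣)
import Data.Integer.Properties as ℤ
open import Data.Integer.GCD using (gcd-greatest)
open import Data.Integer.Tactic.RingSolver using (solve-∀)
open import Data.Rational as ℚ using (ℚ; ↥_; ↧_; 0ℚ)
open ℚ.ℚ using (denominator-1)
open import Data.Rational.Properties using (↥-/; ↧-/)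
open import Data.Product using (_×_; _,_; proj₁; proj₂; uncurry)
open import Data.Bool using (Bool; true; false)
open import Data.List using (List; []; _∷_; map)
open import Relation.Binary.PropositionalEquality using (refl; sym; trans; cong; cong₂; subst; module ≡-Reasoning)
open import Relation.Nullary.Decidable using (does; does-⇔)

↥↧-/-primitive : (n : ℤ) (d : ℕ) .{{_ : ℕ.NonZero d}} (g : ℕ) {{_ : ℕ.NonZero g}} {n′ d′ x y : ℤ} →
                 n ≡ + g * n′ → + d ≡ + g * d′ → d′ * x - n′ * y ≡ + 1 →
                 ↥ (n ℚ./ d) ≡ n′ × ↧ (n ℚ./ d) ≡ d′
↥↧-/-primitive n d g {n′} {d′} {x} {y} n≡gn′ d≡gd′ bezout =
  cancel (↥-/ n d) n≡gn′ , cancel (↧-/ n d) d≡gd′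
  where
  -- g ∣ G since g divides n and d; G ∣ g since g = d x - n y by the Bézout relation.
  G : ℕ
  G = ℕ.gcd ∣ n ∣ d

  factor-∣ : ∀ {i j} → i ≡ + g * j → g ℕ.∣ ∣ i ∣
  factor-∣ {i} {j} i≡gj =
    ℕ.divides ∣ j ∣ (trans (cong ∣_∣ i≡gj) (trans (ℤ.abs-* (+ g) j) (ℕ.*-comm g ∣ j ∣)))

  combination : ℤ
  combination = ↧ (n ℚ./ d) * x - ↥ (n ℚ./ d) * y

  g≡combination : + g ≡ combination * + G
  g≡combination = begin
    + g                                       ≡⟨ ℤ.*-identityʳ (+ g) ⟨
    + g * + 1                                 ≡⟨ cong (+ g *_) bezout ⟨
    + g * (d′ * x - n′ * y)                   ≡⟨ distrib (+ g) d′ n′ x y ⟩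
    (+ g * d′) * x - (+ g * n′) * y           ≡⟨ cong₂ (λ D N → D * x - N * y) d≡gd′ n≡gn′ ⟨
    + d * x - n * y                           ≡⟨ cong₂ (λ D N → D * x - N * y) (↧-/ n d) (↥-/ n d) ⟨
    (↧ (n ℚ./ d) * + G) * x - (↥ (n ℚ./ d) * + G) * y
                                              ≡⟨ pull-out (↧ (n ℚ./ d)) (↥ (n ℚ./ d)) (+ G) x y ⟩
    combination * + G                         ∎
    where
    open ≡-Reasoning
    pull-out : ∀ D N k x y → (D * k) * x - (N * k) * y ≡ (D * x - N * y) * k
    pull-out = solve-∀
    distrib : ∀ k D N x y → k * (D * x - N * y) ≡ (k * D) * x - (k * N) * y
    distrib = solve-∀

  G≡g : G ≡ g
  G≡g = ℕ.∣-antisym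
    (ℕ.divides ∣ combination ∣ (trans (cong ∣_∣ g≡combination) (ℤ.abs-* combination (+ G))))
    (gcd-greatest {n} {+ d} {+ g} (factor-∣ n≡gn′) (factor-∣ d≡gd′))

  cancel : ∀ {i j k} → i * + G ≡ j → j ≡ + g * k → i ≡ k
  cancel {i} {j} {k} iG≡j j≡gk = ℤ.*-cancelʳ-≡ i k (+ g)
    (trans (cong (λ h → i * + h) (sym G≡g)) (trans iG≡j (trans j≡gk (ℤ.*-comm (+ g) k))))

↧-left-ins-unreduced : ∀ a b →
  + suc (denominator-1 a ℕ.+ (suc (denominator-1 a) ℕ.+ suc (denominator-1 b))) ≡ + 2 * ↧ a + ↧ b
↧-left-ins-unreduced a b = begin
  + suc (denominator-1 a ℕ.+ (suc (denominator-1 a) ℕ.+ suc (denominator-1 b)))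
    ≡⟨ ℤ.pos-+ (suc (denominator-1 a)) _ ⟩
  ↧ a + + (suc (denominator-1 a) ℕ.+ suc (denominator-1 b))
    ≡⟨ cong (λ s → ↧ a + s) (ℤ.pos-+ (suc (denominator-1 a)) (suc (denominator-1 b))) ⟩
  ↧ a + (↧ a + ↧ b)
    ≡⟨ collect (↧ a) (↧ b) ⟩
  + 2 * ↧ a + ↧ b ∎
  where
  open ≡-Reasoning
  collect : ∀ q s → q + (q + s) ≡ + 2 * q + s
  collect = solve-∀

↧-right-ins-unreduced : ∀ a b →
  + suc (denominator-1 a ℕ.+ (suc (denominator-1 b) ℕ.+ suc (denominator-1 b))) ≡ ↧ a + + 2 * ↧ b
↧-right-ins-unreduced a b = begin
  + suc (denominator-1 a ℕ.+ (suc (denominator-1 b) ℕ.+ suc (denominator-1 b)))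
    ≡⟨ ℤ.pos-+ (suc (denominator-1 a)) _ ⟩
  ↧ a + + (suc (denominator-1 b) ℕ.+ suc (denominator-1 b))
    ≡⟨ cong (λ s → ↧ a + s) (ℤ.pos-+ (suc (denominator-1 b)) (suc (denominator-1 b))) ⟩
  ↧ a + (↧ b + ↧ b)
    ≡⟨ collect (↧ a) (↧ b) ⟩
  ↧ a + + 2 * ↧ b ∎
  where
  open ≡-Reasoning
  collect : ∀ q s → q + (s + s) ≡ q + + 2 * s
  collect = solve-∀

left-ins-lowest : ∀ a b (g : ℕ) {{_ : ℕ.NonZero g}} {r s n d x y : ℤ} → ↥ b ≡ r → ↧ b ≡ s →
                  + 2 * ↥ a + r ≡ + g * n → + 2 * ↧ a + s ≡ + g * d → d * x - n * y ≡ + 1 →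
                  ↥ left-ins a b ≡ n × ↧ left-ins a b ≡ d
left-ins-lowest a b g refl refl num den =
  ↥↧-/-primitive (+ 2 * ↥ a + ↥ b) _ g num (trans (↧-left-ins-unreduced a b) den)

right-ins-lowest : ∀ a b (g : ℕ) {{_ : ℕ.NonZero g}} {r s n d x y : ℤ} → ↥ b ≡ r → ↧ b ≡ s →
                   ↥ a + + 2 * r ≡ + g * n → ↧ a + + 2 * s ≡ + g * d → d * x - n * y ≡ + 1 →
                   ↥ right-ins a b ≡ n × ↧ right-ins a b ≡ d
right-ins-lowest a b g refl refl num den =
  ↥↧-/-primitive (↥ a + + 2 * ↥ b) _ g num (trans (↧-right-ins-unreduced a b) den)

record Link (σ m : ℤ) (a b : ℚ) : Set where
  constructor link
  field
    w₁ w₂      : ℤ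
    ↥-step     : ↥ b ≡ σ * ↥ a + m * w₁
    ↧-step     : ↧ b ≡ σ * ↧ a + m * w₂
    unimodular : ↧ a * w₁ - ↥ a * w₂ ≡ + 1

link-from : ∀ {σ m a b n d} (w₁ w₂ : ℤ) → ↥ a ≡ n → ↧ a ≡ d →
            ↥ b ≡ σ * n + m * w₁ → ↧ b ≡ σ * d + m * w₂ → d * w₁ - n * w₂ ≡ + 1 →
            Link σ m a b
link-from w₁ w₂ refl refl = link w₁ w₂

cross-Link : ∀ {σ m a b} → Link σ m a b → cross a b ≡ m
cross-Link {σ} {m} {a} {b} (link w₁ w₂ ↥-step ↧-step unimodular) = begin
  ↧ a * ↥ b - ↥ a * ↧ b
    ≡⟨ cong₂ (λ r s → ↧ a * r - ↥ a * s) ↥-step ↧-step ⟩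
  ↧ a * (σ * ↥ a + m * w₁) - ↥ a * (σ * ↧ a + m * w₂)
    ≡⟨ expand (↥ a) (↧ a) σ m w₁ w₂ ⟩
  m * (↧ a * w₁ - ↥ a * w₂)
    ≡⟨ cong (m *_) unimodular ⟩
  m * + 1
    ≡⟨ ℤ.*-identityʳ m ⟩
  m ∎
  where
  open ≡-Reasoning
  expand : ∀ p q σ m w₁ w₂ → q * (σ * p + m * w₁) - p * (σ * q + m * w₂) ≡ m * (q * w₁ - p * w₂)
  expand = solve-∀

unimodular-shift : ∀ {n d w₁ w₂} (k : ℤ) → d * w₁ - n * w₂ ≡ + 1 →
                   (+ 1 * d + k * w₂) * w₁ - (+ 1 * n + k * w₁) * w₂ ≡ + 1
unimodular-shift {n} {d} {w₁} {w₂} k det = trans (expand n d k w₁ w₂) det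
  where
  expand : ∀ n d k w₁ w₂ → (+ 1 * d + k * w₂) * w₁ - (+ 1 * n + k * w₁) * w₂ ≡ d * w₁ - n * w₂
  expand = solve-∀

unimodular-reflect : ∀ {n d w₁ w₂} (k : ℤ) → d * w₁ - n * w₂ ≡ + 1 →
                     (-1ℤ * d + k * w₂) * ℤ.- w₁ - (-1ℤ * n + k * w₁) * ℤ.- w₂ ≡ + 1
unimodular-reflect {n} {d} {w₁} {w₂} k det = trans (expand n d k w₁ w₂) det
  where
  expand : ∀ n d k w₁ w₂ → (-1ℤ * d + k * w₂) * ℤ.- w₁ - (-1ℤ * n + k * w₁) * ℤ.- w₂ ≡ d * w₁ - n * w₂
  expand = solve-∀

data State : Set where
  plus minus : ℕ → State

sign : State → ℤ
sign (plus _)  = + 1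
sign (minus _) = -1ℤ

modulus : State → ℤ
modulus (plus e)  = (+ 3) ℤ.^ e
modulus (minus e) = (+ 3) ℤ.^ suc e

Linked : State → ℚ → ℚ → Set
Linked s = Link (sign s) (modulus s)

record ChildrenLinked (s₀ s₁ s₂ : State) (a b : ℚ) : Set where
  constructor children-linked
  field
    first  : Linked s₀ a (left-ins a b)
    second : Linked s₁ (left-ins a b) (right-ins a b)
    third  : Linked s₂ (right-ins a b) b

-- As m = 1, the witness may be changed: L = 3a + w = a + v for v = 2a + w, and det(a, v) = det(a, w).
plus-zero-children : ∀ {a b} → Linked (plus 0) a b → ChildrenLinked (plus 0) (minus 0) (plus 0) a b
plus-zero-children {a} {b} (link w₁ w₂ ↥b ↧b det) = children-linked
  (link v₁ v₂ (proj₁ L-lowest) (proj₂ L-lowest) det-v)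
  (link-from v₁ v₂ (proj₁ L-lowest) (proj₂ L-lowest) (proj₁ R-lowest) (proj₂ R-lowest) det-L)
  (link-from (ℤ.- v₁) (ℤ.- v₂) (proj₁ R-lowest) (proj₂ R-lowest)
     (trans ↥b (right-to-b (↥ a) w₁)) (trans ↧b (right-to-b (↧ a) w₂)) det-R)
  where
  v₁ v₂ : ℤ
  v₁ = + 2 * ↥ a + w₁
  v₂ = + 2 * ↧ a + w₂
  unimodular-v : ∀ p q w₁ w₂ → q * (+ 2 * p + w₁) - p * (+ 2 * q + w₂) ≡ q * w₁ - p * w₂
  unimodular-v = solve-∀
  det-v : ↧ a * v₁ - ↥ a * v₂ ≡ + 1
  det-v = trans (unimodular-v (↥ a) (↧ a) w₁ w₂) det
  nL dL nR dR : ℤ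
  nL = + 1 * ↥ a + + 1 * v₁
  dL = + 1 * ↧ a + + 1 * v₂
  nR = -1ℤ * nL + + 3 * v₁
  dR = -1ℤ * dL + + 3 * v₂
  det-L : dL * v₁ - nL * v₂ ≡ + 1
  det-L = unimodular-shift {↥ a} {↧ a} {v₁} {v₂} (+ 1) det-v
  det-R : dR * ℤ.- v₁ - nR * ℤ.- v₂ ≡ + 1
  det-R = unimodular-reflect {nL} {dL} {v₁} {v₂} (+ 3) det-L
  left : ∀ x w → + 2 * x + (+ 1 * x + + 1 * w) ≡ + 1 * (+ 1 * x + + 1 * (+ 2 * x + w))
  left = solve-∀
  right : ∀ x w → x + + 2 * (+ 1 * x + + 1 * w) ≡ + 1 * (-1ℤ * (+ 1 * x + + 1 * (+ 2 * x + w)) + + 3 * (+ 2 * x + w))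
  right = solve-∀
  right-to-b : ∀ x w → + 1 * x + + 1 * w ≡
               + 1 * (-1ℤ * (+ 1 * x + + 1 * (+ 2 * x + w)) + + 3 * (+ 2 * x + w)) + + 1 * ℤ.- (+ 2 * x + w)
  right-to-b = solve-∀
  L-lowest : ↥ left-ins a b ≡ nL × ↧ left-ins a b ≡ dL
  L-lowest = left-ins-lowest a b 1 ↥b ↧b (left (↥ a) w₁) (left (↧ a) w₂) det-L
  R-lowest : ↥ right-ins a b ≡ nR × ↧ right-ins a b ≡ dR
  R-lowest = right-ins-lowest a b 1 ↥b ↧b (right (↥ a) w₁) (right (↧ a) w₂) det-R

plus-suc-children : ∀ e {a b} → Linked (plus (suc e)) a b → ChildrenLinked (plus e) (plus e) (plus e) a b
plus-suc-children e {a} {b} (link w₁ w₂ ↥b ↧b det) = children-linked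
  (link w₁ w₂ (proj₁ L-lowest) (proj₂ L-lowest) det)
  (link-from w₁ w₂ (proj₁ L-lowest) (proj₂ L-lowest) (proj₁ R-lowest) (proj₂ R-lowest) det-L)
  (link-from w₁ w₂ (proj₁ R-lowest) (proj₂ R-lowest)
     (trans ↥b (right-to-b F (↥ a) w₁)) (trans ↧b (right-to-b F (↧ a) w₂)) det-R)
  where
  F : ℤ
  F = (+ 3) ℤ.^ e
  nL dL nR dR : ℤ
  nL = + 1 * ↥ a + F * w₁
  dL = + 1 * ↧ a + F * w₂
  nR = + 1 * nL + F * w₁
  dR = + 1 * dL + F * w₂
  det-L : dL * w₁ - nL * w₂ ≡ + 1
  det-L = unimodular-shift {↥ a} {↧ a} {w₁} {w₂} F det
  det-R : dR * w₁ - nR * w₂ ≡ + 1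
  det-R = unimodular-shift {nL} {dL} {w₁} {w₂} F det-L
  left : ∀ F x w → + 2 * x + (+ 1 * x + + 3 * F * w) ≡ + 3 * (+ 1 * x + F * w)
  left = solve-∀
  right : ∀ F x w → x + + 2 * (+ 1 * x + + 3 * F * w) ≡ + 3 * (+ 1 * (+ 1 * x + F * w) + F * w)
  right = solve-∀
  right-to-b : ∀ F x w → + 1 * x + + 3 * F * w ≡ + 1 * (+ 1 * (+ 1 * x + F * w) + F * w) + F * w
  right-to-b = solve-∀
  L-lowest : ↥ left-ins a b ≡ nL × ↧ left-ins a b ≡ dL
  L-lowest = left-ins-lowest a b 3 ↥b ↧b (left F (↥ a) w₁) (left F (↧ a) w₂) det-L
  R-lowest : ↥ right-ins a b ≡ nR × ↧ right-ins a b ≡ dR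
  R-lowest = right-ins-lowest a b 3 ↥b ↧b (right F (↥ a) w₁) (right F (↧ a) w₂) det-R

minus-children : ∀ e {a b} → Linked (minus e) a b → ChildrenLinked (plus (suc e)) (minus (suc e)) (plus (suc e)) a b
minus-children e {a} {b} (link w₁ w₂ ↥b ↧b det) = children-linked
  (link w₁ w₂ (proj₁ L-lowest) (proj₂ L-lowest) det)
  (link-from w₁ w₂ (proj₁ L-lowest) (proj₂ L-lowest) (proj₁ R-lowest) (proj₂ R-lowest) det-L)
  (link-from (ℤ.- w₁) (ℤ.- w₂) (proj₁ R-lowest) (proj₂ R-lowest)
     (trans ↥b (right-to-b E (↥ a) w₁)) (trans ↧b (right-to-b E (↧ a) w₂)) det-R)
  where
  E : ℤ
  E = (+ 3) ℤ.^ suc e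
  nL dL nR dR : ℤ
  nL = + 1 * ↥ a + E * w₁
  dL = + 1 * ↧ a + E * w₂
  nR = -1ℤ * nL + + 3 * E * w₁
  dR = -1ℤ * dL + + 3 * E * w₂
  det-L : dL * w₁ - nL * w₂ ≡ + 1
  det-L = unimodular-shift {↥ a} {↧ a} {w₁} {w₂} E det
  det-R : dR * ℤ.- w₁ - nR * ℤ.- w₂ ≡ + 1
  det-R = unimodular-reflect {nL} {dL} {w₁} {w₂} (+ 3 * E) det-L
  left : ∀ E x w → + 2 * x + (-1ℤ * x + E * w) ≡ + 1 * (+ 1 * x + E * w)
  left = solve-∀
  right : ∀ E x w → x + + 2 * (-1ℤ * x + E * w) ≡ + 1 * (-1ℤ * (+ 1 * x + E * w) + + 3 * E * w)
  right = solve-∀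
  right-to-b : ∀ E x w → -1ℤ * x + E * w ≡ + 1 * (-1ℤ * (+ 1 * x + E * w) + + 3 * E * w) + E * ℤ.- w
  right-to-b = solve-∀
  L-lowest : ↥ left-ins a b ≡ nL × ↧ left-ins a b ≡ dL
  L-lowest = left-ins-lowest a b 1 ↥b ↧b (left E (↥ a) w₁) (left E (↧ a) w₂) det-L
  R-lowest : ↥ right-ins a b ≡ nR × ↧ right-ins a b ≡ dR
  R-lowest = right-ins-lowest a b 1 ↥b ↧b (right E (↥ a) w₁) (right E (↧ a) w₂) det-R

next : State → Bool → State
next (plus zero)    true  = minus 0
next (plus zero)    false = plus 0
next (plus (suc e)) _     = plus e
next (minus e)      true  = minus (suc e)
next (minus e)      false = plus (suc e)

is-one : ℕ → Bool
is-one r = does (r ℕ.≟ 1)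

child : ℕ → ℚ × ℚ → ℚ × ℚ
child zero                (a , b) = a , left-ins a b
child (suc zero)          (a , b) = left-ins a b , right-ins a b
child (suc (suc _))       (a , b) = right-ins a b , b

child-linked : ∀ s {a b} → Linked s a b → ∀ r → uncurry (Linked (next s (is-one r))) (child r (a , b))
child-linked (plus zero)    ℓ zero          = ChildrenLinked.first  (plus-zero-children ℓ)
child-linked (plus zero)    ℓ (suc zero)    = ChildrenLinked.second (plus-zero-children ℓ)
child-linked (plus zero)    ℓ (suc (suc _)) = ChildrenLinked.third  (plus-zero-children ℓ)
child-linked (plus (suc e)) ℓ zero          = ChildrenLinked.first  (plus-suc-children e ℓ)
child-linked (plus (suc e)) ℓ (suc zero)    = ChildrenLinked.second (plus-suc-children e ℓ)
child-linked (plus (suc e)) ℓ (suc (suc _)) = ChildrenLinked.third  (plus-suc-children e ℓ)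
child-linked (minus e)      ℓ zero          = ChildrenLinked.first  (minus-children e ℓ)
child-linked (minus e)      ℓ (suc zero)    = ChildrenLinked.second (minus-children e ℓ)
child-linked (minus e)      ℓ (suc (suc _)) = ChildrenLinked.third  (minus-children e ℓ)

pairs : List ℚ → List (ℚ × ℚ)
pairs []            = []
pairs (a ∷ [])      = []
pairs (a ∷ b ∷ cs)  = (a , b) ∷ pairs (b ∷ cs)

children : List (ℚ × ℚ) → List (ℚ × ℚ)
children []        = []
children (ab ∷ ps) = child 0 ab ∷ child 1 ab ∷ child 2 ab ∷ children ps

pairs-cons-refine : ∀ a b cs → pairs (a ∷ refine (b ∷ cs)) ≡ (a , b) ∷ pairs (refine (b ∷ cs))
pairs-cons-refine a b []       = refl
pairs-cons-refine a b (c ∷ cs) = refl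

pairs-refine : ∀ xs → pairs (refine xs) ≡ children (pairs xs)
pairs-refine []           = refl
pairs-refine (a ∷ [])     = refl
pairs-refine (a ∷ b ∷ cs) =
  cong (λ ps → (a , left-ins a b) ∷ (left-ins a b , right-ins a b) ∷ ps)
    (trans (pairs-cons-refine (right-ins a b) b cs) (cong ((right-ins a b , b) ∷_) (pairs-refine (b ∷ cs))))

crossList≡map-cross-pairs : ∀ xs → crossList xs ≡ map (uncurry cross) (pairs xs)
crossList≡map-cross-pairs []           = refl
crossList≡map-cross-pairs (a ∷ [])     = refl
crossList≡map-cross-pairs (a ∷ b ∷ cs) = cong (cross a b ∷_) (crossList≡map-cross-pairs (b ∷ cs))

nthOr-map : ∀ {A B : Set} (f : A → B) (d : A) xs i → nthOr (f d) (map f xs) i ≡ f (nthOr d xs i)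
nthOr-map f d []       i       = refl
nthOr-map f d (x ∷ xs) zero    = refl
nthOr-map f d (x ∷ xs) (suc i) = nthOr-map f d xs i

origin : ℚ × ℚ
origin = 0ℚ , 0ℚ

child-origin : ∀ r → child r origin ≡ origin
child-origin zero          = refl
child-origin (suc zero)    = refl
child-origin (suc (suc _)) = refl

nthOr-children : ∀ ps k {r} → r < 3 → nthOr origin (children ps) (k ℕ.* 3 ℕ.+ r) ≡ child r (nthOr origin ps k)
nthOr-children []        k       {r} _ = sym (child-origin r)
nthOr-children (ab ∷ ps) (suc k)     r<3 = nthOr-children ps k r<3
nthOr-children (ab ∷ ps) zero    {0} _ = refl
nthOr-children (ab ∷ ps) zero    {1} _ = refl
nthOr-children (ab ∷ ps) zero    {2} _ = refl
nthOr-children (ab ∷ ps) zero    {suc (suc (suc _))} (s≤s (s≤s (s≤s ())))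

pair-at : ℕ → ℕ → ℚ × ℚ
pair-at n i = nthOr origin (pairs (SB n)) i

pair-at-suc : ∀ n i → pair-at (suc n) i ≡ child (i % 3) (pair-at n (i / 3))
pair-at-suc n i = begin
  nthOr origin (pairs (refine (SB n))) i
    ≡⟨ cong (λ ps → nthOr origin ps i) (pairs-refine (SB n)) ⟩
  nthOr origin (children (pairs (SB n))) i
    ≡⟨ cong (nthOr origin (children (pairs (SB n)))) i≡[i/3]*3+i%3 ⟩
  nthOr origin (children (pairs (SB n))) ((i / 3) ℕ.* 3 ℕ.+ i % 3)
    ≡⟨ nthOr-children (pairs (SB n)) (i / 3) (ℕ.m%n<n i 3) ⟩
  child (i % 3) (pair-at n (i / 3)) ∎
  where
  open ≡-Reasoning
  i≡[i/3]*3+i%3 : i ≡ (i / 3) ℕ.* 3 ℕ.+ i % 3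
  i≡[i/3]*3+i%3 = trans (ℕ.m≡m%n+[m/n]*n i 3) (ℕ.+-comm (i % 3) _)

state : ℕ → ℕ → State
state zero    _ = plus 0
state (suc n) i = next (state n (i / 3)) (is-one (i % 3))

pair-at-linked : ∀ n i → i < 3 ^ n → uncurry (Linked (state n i)) (pair-at n i)
pair-at-linked zero    zero    _ = link (+ 1) (+ 0) refl refl refl
pair-at-linked zero    (suc i) (s≤s ())
pair-at-linked (suc n) i i<3^[1+n] rewrite pair-at-suc n i =
  child-linked (state n (i / 3)) (pair-at-linked n (i / 3) i/3<3^n) (i % 3)
  where
  i/3<3^n : i / 3 < 3 ^ n
  i/3<3^n = ℕ.m<n*o⇒m/o<n (subst (i <_) (ℕ.*-comm 3 (3 ^ n)) i<3^[1+n])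

C≡modulus-state : ∀ n i → i < 3 ^ n → C n i ≡ modulus (state n i)
C≡modulus-state n i i<3^n = begin
  nthOr (+ 0) (crossList (SB n)) i
    ≡⟨ cong (λ cs → nthOr (+ 0) cs i) (crossList≡map-cross-pairs (SB n)) ⟩
  nthOr (uncurry cross origin) (map (uncurry cross) (pairs (SB n))) i
    ≡⟨ nthOr-map (uncurry cross) origin (pairs (SB n)) i ⟩
  uncurry cross (pair-at n i)
    ≡⟨ cross-Link (pair-at-linked n i i<3^n) ⟩
  modulus (state n i) ∎
  where open ≡-Reasoning

state-respects-ones : ∀ n {i j} → (∀ t → (ternaryDigit t i ≡ 1) ⇔ (ternaryDigit t j ≡ 1)) → state n i ≡ state n j
state-respects-ones zero    _    = refl
state-respects-ones (suc n) {i} {j} ones =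
  cong₂ next (state-respects-ones n (λ t → ones (suc t))) (does-⇔ (ones 0) (i % 3 ℕ.≟ 1) (j % 3 ℕ.≟ 1))

lemma24 : (n i j : ℕ) → i < 3 ^ n → j < 3 ^ n →
          ((t : ℕ) → (ternaryDigit t i ≡ 1) ⇔ (ternaryDigit t j ≡ 1)) →
          C n i ≡ C n j
lemma24 n i j i<3^n j<3^n ones = begin
  C n i               ≡⟨ C≡modulus-state n i i<3^n ⟩
  modulus (state n i) ≡⟨ cong modulus (state-respects-ones n ones) ⟩
  modulus (state n j) ≡⟨ C≡modulus-state n j j<3^n ⟨
  C n j               ∎
  where open ≡-Reasoning
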